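{- Let $T$ be a canonical $\lambda_\epsilon$-term and $\tau$ a type with $\vdash T:\tau$ (empty context). Then either $T$ is a canonical value, i.e. $T=\epsilon^{k_1}(\lambda x_1.t_1)+(\cdots+\epsilon^{k_n}(\lambda x_n.t_n))$ for some $n\ge0$ ($n=0$ meaning $T=0$), or there is a term $t'$ with $T\to t'$.
   Context: Unrestricted terms: $t ::= x \mid \lambda x.t \mid (s\ t) \mid \mathsf{D}(s)\cdot t \mid \epsilon t \mid s+t \mid 0$, up to $\alpha$-equivalence; $\epsilon^k t$ is $k$-fold $\epsilon$ ($\epsilon^0 t=t$). Canonical terms: basic terms $s^b,t^b ::= x \mid \lambda x.t^b \mid (s^b\ t^*) \mid \mathsf{D}(s^b)\cdot t^b$; positive terms $s^+ ::= s^b\mid s^b+(t^+)$; additive terms $t^*::=0\mid s^+$; positive canonical $S^+::=\epsilon^k s^b\mid \epsilon^k s^b+(S^+)$; canonical $S::=0\mid S^+$. $t[s/x]$ is capture-avoiding substitution. Differential substitution $\frac{\partial t}{\partial x}(s)$ (for $x$ not free in $s$): $\frac{\partial x}{\partial x}(s)=s$; $\frac{\partial y}{\partial x}(s)=0$ ($y\ne x$); $\frac{\partial(\lambda y.t)}{\partial x}(s)=\lambda y.\frac{\partial t}{\partial x}(s)$; $\frac{\partial(t\ e)}{\partial x}(s)=\big((\mathsf{D}(t)\cdot\frac{\partial e}{\partial x}(s))\ e\big)+\big(\frac{\partial t}{\partial x}(s)\ (e[x+\epsilon s/x])\big)$; $\frac{\partial(\mathsf{D}(t)\cdot e)}{\partial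 x}(s)=\mathsf{D}(t)\cdot\frac{\partial e}{\partial x}(s)+\mathsf{D}(\frac{\partial t}{\partial x}(s))\cdot(e[x+\epsilon s/x])+\epsilon\big(\mathsf{D}(\mathsf{D}(t)\cdot e)\cdot\frac{\partial e}{\partial x}(s)\big)$; $\frac{\partial(\epsilon t)}{\partial x}(s)=\epsilon\frac{\partial t}{\partial x}(s)$; $\frac{\partial(t+e)}{\partial x}(s)=\frac{\partial t}{\partial x}(s)+\frac{\partial e}{\partial x}(s)$; $\frac{\partial 0}{\partial x}(s)=0$. One-step reduction $\to$ is the closure under term contexts of $(\lambda x.t)\ s\to t[s/x]$ and $\mathsf{D}(\lambda x.t)\cdot s\to\lambda x.\frac{\partial t}{\partial x}(s)$. Types: $\sigma,\tau ::= \mathbf{t}\mid\sigma\Rightarrow\tau$. Typing rules: $\Gamma\vdash x:\tau$ if $x:\tau$ occurs in $\Gamma$; from $\Gamma\vdash s:\tau\Rightarrow\sigma$ and $\Gamma\vdash t:\tau$ infer $\Gamma\vdash(s\ t):\sigma$ and $\Gamma\vdash\mathsf{D}(s)\cdot t:\tau\Rightarrow\sigma$; from $\Gamma,x:\tau\vdash t:\sigma$ infer $\Gamma\vdash\lambda x.t:\tau\Rightarrow\sigma$; $\Gamma\vdash 0:\tau$ for every $\tau$; from $\Gamma\vdash s:\tau$, $\Gamma\vdash t:\tau$ infer $\Gamma\vdash s+t:\tau$; from $\Gamma\vdash t:\tau$ infer $\Gamma\vdash\epsilon t:\tau$. -}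

module Defs where

open import Data.Nat using (ℕ; zero; suc; _≟_)
open import Data.List using (List; []; _∷_)
open import Relation.Nullary using (yes; no)

-- Terms of the differential λε-calculus, in de Bruijn notation
-- (so α-equivalence is syntactic equality).

infixr 5 _⊕_

data Term : Set where
  var  : ℕ → Term
  lam  : Term → Term
  app  : Term → Term → Term
  D    : Term → Term → Term
  eps  : Term → Term
  _⊕_  : Term → Term → Term
  𝟘    : Term

epsPow : ℕ → Term → Term
epsPow zero    t = t
epsPow (suc k) t = eps (epsPow k t)

Ren : Set
Ren = ℕ → ℕ

extR : Ren → Ren
extR ρ zero    = zero
extR ρ (suc n) = suc (ρ n)

rename : Ren → Term → Term
rename ρ (var n)   = var (ρ n)
rename ρ (lam t)   = lam (rename (extR ρ) t)
rename ρ (app s t) = app (rename ρ s) (rename ρ t)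
rename ρ (D s t)   = D (rename ρ s) (rename ρ t)
rename ρ (eps t)   = eps (rename ρ t)
rename ρ (s ⊕ t)   = rename ρ s ⊕ rename ρ t
rename ρ 𝟘         = 𝟘

shift : Term → Term
shift = rename suc

Sub : Set
Sub = ℕ → Term

extS : Sub → Sub
extS σ zero    = var zero
extS σ (suc n) = shift (σ n)

subst : Sub → Term → Term
subst σ (var n)   = σ n
subst σ (lam t)   = lam (subst (extS σ) t)
subst σ (app s t) = app (subst σ s) (subst σ t)
subst σ (D s t)   = D (subst σ s) (subst σ t)
subst σ (eps t)   = eps (subst σ t)
subst σ (s ⊕ t)   = subst σ s ⊕ subst σ t
subst σ 𝟘         = 𝟘

single : Term → Sub
single s zero    = s
single s (suc n) = var n

_[_/0] : Term → Term → Term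
t [ s /0] = subst (single s) t

replaceVar : ℕ → Term → Sub
replaceVar n u m with m ≟ n
... | yes _ = u
... | no  _ = var m

-- Differential substitution  ∂t/∂x(s), with x the de Bruijn index n.
-- s lives in the same context as t; x not free in s is ensured by the
-- only caller (the D-β rule), which passes a weakened s.

deriv : ℕ → Term → Term → Term
deriv n (var m) s with m ≟ n
... | yes _ = s
... | no  _ = 𝟘
deriv n (lam t)   s = lam (deriv (suc n) t (shift s))
deriv n (app t e) s =
  app (D t (deriv n e s)) e
  ⊕ app (deriv n t s) (subst (replaceVar n (var n ⊕ eps s)) e)
deriv n (D t e)   s =
  D t (deriv n e s)
  ⊕ (D (deriv n t s) (subst (replaceVar n (var n ⊕ eps s)) e)
  ⊕ eps (D (D t e) (deriv n e s)))
deriv n (eps t)   s = eps (deriv n t s)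
deriv n (t ⊕ e)   s = deriv n t s ⊕ deriv n e s
deriv n 𝟘         s = 𝟘

infix 4 _⟶_

data _⟶_ : Term → Term → Set where
  β      : ∀ {t s} → app (lam t) s ⟶ t [ s /0]
  Dβ     : ∀ {t s} → D (lam t) s ⟶ lam (deriv zero t (shift s))
  ξ-lam  : ∀ {t t'} → t ⟶ t' → lam t ⟶ lam t'
  ξ-appₗ : ∀ {s s' t} → s ⟶ s' → app s t ⟶ app s' t
  ξ-appᵣ : ∀ {s t t'} → t ⟶ t' → app s t ⟶ app s t'
  ξ-Dₗ   : ∀ {s s' t} → s ⟶ s' → D s t ⟶ D s' t
  ξ-Dᵣ   : ∀ {s t t'} → t ⟶ t' → D s t ⟶ D s t'
  ξ-eps  : ∀ {t t'} → t ⟶ t' → eps t ⟶ eps t'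
  ξ-⊕ₗ   : ∀ {s s' t} → s ⟶ s' → s ⊕ t ⟶ s' ⊕ t
  ξ-⊕ᵣ   : ∀ {s t t'} → t ⟶ t' → s ⊕ t ⟶ s ⊕ t'

mutual
  data Basic : Term → Set where
    b-var : ∀ {n} → Basic (var n)
    b-lam : ∀ {t} → Basic t → Basic (lam t)
    b-app : ∀ {s t} → Basic s → Additive t → Basic (app s t)
    b-D   : ∀ {s t} → Basic s → Basic t → Basic (D s t)

  data Positive : Term → Set where
    p-one  : ∀ {s} → Basic s → Positive s
    p-cons : ∀ {s t} → Basic s → Positive t → Positive (s ⊕ t)

  data Additive : Term → Set where
    a-zero : Additive 𝟘
    a-pos  : ∀ {t} → Positive t → Additive t

data PosCanonical : Term → Set where
  pc-one  : ∀ {k s} → Basic s → PosCanonical (epsPow k s)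
  pc-cons : ∀ {k s S} → Basic s → PosCanonical S → PosCanonical (epsPow k s ⊕ S)

data Canonical : Term → Set where
  c-zero : Canonical 𝟘
  c-pos  : ∀ {S} → PosCanonical S → Canonical S

data PosCanonicalValue : Term → Set where
  pv-one  : ∀ {k t} → PosCanonicalValue (epsPow k (lam t))
  pv-cons : ∀ {k t V} → PosCanonicalValue V → PosCanonicalValue (epsPow k (lam t) ⊕ V)

data CanonicalValue : Term → Set where
  cv-zero : CanonicalValue 𝟘
  cv-pos  : ∀ {V} → PosCanonicalValue V → CanonicalValue V

infixr 6 _⇒_
data Type : Set where
  𝐭   : Type
  _⇒_ : Type → Type → Type

Ctx : Set
Ctx = List Type

infix 4 _∋_∶_ _⊢_∶_

data _∋_∶_ : Ctx → ℕ → Type → Set where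
  here  : ∀ {Γ τ} → (τ ∷ Γ) ∋ zero ∶ τ
  there : ∀ {Γ σ τ n} → Γ ∋ n ∶ τ → (σ ∷ Γ) ∋ suc n ∶ τ

data _⊢_∶_ : Ctx → Term → Type → Set where
  ⊢var : ∀ {Γ n τ} → Γ ∋ n ∶ τ → Γ ⊢ var n ∶ τ
  ⊢app : ∀ {Γ s t τ σ} → Γ ⊢ s ∶ τ ⇒ σ → Γ ⊢ t ∶ τ → Γ ⊢ app s t ∶ σ
  ⊢D   : ∀ {Γ s t τ σ} → Γ ⊢ s ∶ τ ⇒ σ → Γ ⊢ t ∶ τ → Γ ⊢ D s t ∶ τ ⇒ σ
  ⊢lam : ∀ {Γ t τ σ} → (τ ∷ Γ) ⊢ t ∶ σ → Γ ⊢ lam t ∶ τ ⇒ σ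
  ⊢𝟘   : ∀ {Γ τ} → Γ ⊢ 𝟘 ∶ τ
  ⊢⊕   : ∀ {Γ s t τ} → Γ ⊢ s ∶ τ → Γ ⊢ t ∶ τ → Γ ⊢ s ⊕ t ∶ τ
  ⊢eps : ∀ {Γ t τ} → Γ ⊢ t ∶ τ → Γ ⊢ eps t ∶ τ

{-# OPTIONS --safe #-}
module Submission where

-- A closed basic term cannot be a variable, so its head is a λ: either it is
-- itself a λ, or its leftmost application/derivative has a λ in function
-- position and fires a β or D-β redex. A canonical term is a sum of ε-powers of
-- basic terms, so it either consists of λs only or one summand reduces.

open import Defs
open import Data.Nat using (zero; suc)
open import Data.List using (List; [])
open import Data.Sum using (_⊎_; inj₁; inj₂)
open import Data.Product using (∃-syntax; _,_)

data IsLam : Term → Set where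
  lam : ∀ {t} → IsLam (lam t)

epsPow-⊢⁻¹ : ∀ k {Γ : List Type} {t τ} → Γ ⊢ epsPow k t ∶ τ → Γ ⊢ t ∶ τ
epsPow-⊢⁻¹ zero    ⊢t       = ⊢t
epsPow-⊢⁻¹ (suc k) (⊢eps ⊢t) = epsPow-⊢⁻¹ k ⊢t

ξ-epsPow : ∀ k {t t'} → t ⟶ t' → epsPow k t ⟶ epsPow k t'
ξ-epsPow zero    r = r
ξ-epsPow (suc k) r = ξ-eps (ξ-epsPow k r)

basic-progress : ∀ {s τ} → Basic s → [] ⊢ s ∶ τ → IsLam s ⊎ ∃[ s' ] (s ⟶ s')
basic-progress b-var (⊢var ())
basic-progress (b-lam _) _ = inj₁ lam
basic-progress (b-app bs _) (⊢app ⊢s _) with basic-progress bs ⊢s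
... | inj₁ lam      = inj₂ (_ , β)
... | inj₂ (_ , r)  = inj₂ (_ , ξ-appₗ r)
basic-progress (b-D bs _) (⊢D ⊢s _) with basic-progress bs ⊢s
... | inj₁ lam      = inj₂ (_ , Dβ)
... | inj₂ (_ , r)  = inj₂ (_ , ξ-Dₗ r)

posCanonical-progress : ∀ {S τ} → PosCanonical S → [] ⊢ S ∶ τ →
                        PosCanonicalValue S ⊎ ∃[ S' ] (S ⟶ S')
posCanonical-progress (pc-one {k} b) ⊢S with basic-progress b (epsPow-⊢⁻¹ k ⊢S)
... | inj₁ lam      = inj₁ pv-one
... | inj₂ (_ , r)  = inj₂ (_ , ξ-epsPow k r)
posCanonical-progress (pc-cons {k} b p) (⊢⊕ ⊢s ⊢S) with basic-progress b (epsPow-⊢⁻¹ k ⊢s)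
... | inj₂ (_ , r)  = inj₂ (_ , ξ-⊕ₗ (ξ-epsPow k r))
... | inj₁ lam with posCanonical-progress p ⊢S
...   | inj₁ v        = inj₁ (pv-cons v)
...   | inj₂ (_ , r)  = inj₂ (_ , ξ-⊕ᵣ r)

mainTheorem14 : (T : Term) (τ : Type) → Canonical T → [] ⊢ T ∶ τ →
                  CanonicalValue T ⊎ ∃[ t' ] (T ⟶ t')
mainTheorem14 .𝟘 _ c-zero  _  = inj₁ cv-zero
mainTheorem14 _  _ (c-pos p) ⊢T with posCanonical-progress p ⊢T
... | inj₁ v = inj₁ (cv-pos v)
... | inj₂ r = inj₂ r
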